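{- Let $\mathcal X$ be a zero-nonzero pattern. Then $L(\mathcal X)^*\simeq L(\mathcal X^T)$, with a lattice isomorphism $\phi:L(\mathcal X)^*\to L(\mathcal X^T)$ given by $\phi(A)=Z(A)$.
   Context: A zero-nonzero pattern is a matrix with entries in $\{0,*\}$. For a row label $x$, $Z(x)$ is the set of column labels where row $x$ has entry $0$; for a column label $x$, $Z(x)$ is the set of row labels where column $x$ has entry $0$; for a set $A$ of column labels, $Z(A)=\bigcap_{a\in A}Z(a)$ (a set of row labels of $\mathcal X$, i.e., of column labels of $\mathcal X^T$). The intersection lattice $L(\mathcal X)$ is the set of all intersections of zero sets of rows of $\mathcal X$ (the empty intersection being the full set of column labels), ordered by inclusion. For a lattice $L$, the dual lattice $L^*$ is the same set with all order relations reversed. -}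

module Defs where

open import Data.Bool using (Bool; true; false; not)
open import Data.Nat using (ℕ)
open import Data.Fin using (Fin)
open import Data.Fin.Subset using (Subset; ⋂; _⊆_)
open import Data.List using (map; filterᵇ; allFin)
open import Data.Vec using (tabulate; lookup)
open import Data.Product using (Σ; _×_)
open import Function.Base using (flip)
open import Relation.Binary.PropositionalEquality using (_≡_)

-- A zero-nonzero pattern with m rows (labels Fin m) and n columns (labels Fin n).
-- Entry true = *, entry false = 0.
Pattern : ℕ → ℕ → Set
Pattern m n = Fin m → Fin n → Bool

transpose : ∀ {m n} → Pattern m n → Pattern n m
transpose X = flip X

-- Zero set of a row x: the column labels where row x has entry 0.
-- (The zero set of a column a of X is  Zrow (transpose X) a.)
Zrow : ∀ {m n} → Pattern m n → Fin m → Subset n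
Zrow X x = tabulate (λ j → not (X x j))

-- Z(R) = ⋂_{r ∈ R} Z(r) for a set R of row labels (empty intersection = everything).
-- For a set A of column labels of X, Z(A) is  Zset (transpose X) A.
Zset : ∀ {m n} → Pattern m n → Subset m → Subset n
Zset {m} X R = ⋂ (map (Zrow X) (filterᵇ (lookup R) (allFin m)))

InL : ∀ {m n} → Pattern m n → Subset n → Set
InL {m} X A = Σ (Subset m) (λ R → A ≡ Zset X R)

-- L(X) and L(Xᵀ) are the closed sets of the Galois connection between row sets and
-- column sets given by Z: a row set R and a column set A satisfy A ⊆ Z(R) iff
-- R ⊆ Z(A), both saying that X vanishes on R × A.  Hence Z is antitone, R ⊆ Z(Z(R)),
-- and Z ∘ Z ∘ Z = Z, so Z ∘ Z is the identity on every Z(R), i.e. on L(X).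
module Submission where

open import Defs
open import Data.Bool using (Bool; false; T; T?)
open import Data.Bool.Properties using (T-≡; T-not-≡)
open import Data.Fin using (Fin)
open import Data.Fin.Subset using (Subset; _⊆_; _∈_; ⋂)
open import Data.Fin.Subset.Properties using (∈⊤; x∈p∩q⁺; x∈p∩q⁻; ⊆-antisym)
open import Data.List using (List; []; _∷_; allFin)
open import Data.List.Relation.Unary.Any using (here; there)
import Data.List.Membership.Propositional as List
open import Data.List.Membership.Propositional.Properties
  using (∈-allFin; ∈-map∘filter⁺; ∈-map∘filter⁻)
open import Data.Vec using (tabulate; lookup)
open import Data.Vec.Properties using ([]=⇒lookup; lookup⇒[]=; lookup∘tabulate)
open import Data.Product using (Σ; _×_; _,_; proj₁; proj₂)
open import Function.Base using (_∘_)
open import Function.Bundles using (_⇔_; mk⇔; Equivalence)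
open import Relation.Binary.PropositionalEquality 
  using (_≡_; refl; sym; cong; subst; subst₂; module ≡-Reasoning)

open Equivalence using (to; from)

∈-⋂⁺ : ∀ {n} {x : Fin n} (ps : List (Subset n)) → (∀ {p} → p List.∈ ps → x ∈ p) → x ∈ ⋂ ps
∈-⋂⁺ []       x∈ps = ∈⊤
∈-⋂⁺ (p ∷ ps) x∈ps = x∈p∩q⁺ (x∈ps (here refl) , ∈-⋂⁺ ps (x∈ps ∘ there))

∈-⋂⁻ : ∀ {n} {x : Fin n} {p} (ps : List (Subset n)) → x ∈ ⋂ ps → p List.∈ ps → x ∈ p
∈-⋂⁻ (p ∷ ps) x∈⋂ (here refl) = proj₁ (x∈p∩q⁻ p (⋂ ps) x∈⋂)
∈-⋂⁻ (p ∷ ps) x∈⋂ (there p∈)  = ∈-⋂⁻ ps (proj₂ (x∈p∩q⁻ p (⋂ ps) x∈⋂)) p∈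

∈⇔T-lookup : ∀ {n} {R : Subset n} {i : Fin n} → i ∈ R ⇔ T (lookup R i)
∈⇔T-lookup = mk⇔ (from T-≡ ∘ []=⇒lookup) (lookup⇒[]= _ _ ∘ to T-≡)

∈-tabulate : ∀ {n} {f : Fin n → Bool} {j : Fin n} → j ∈ tabulate f ⇔ T (f j)
∈-tabulate {f = f} {j} = mk⇔
  (subst T (lookup∘tabulate f j) ∘ to ∈⇔T-lookup)
  (from ∈⇔T-lookup ∘ subst T (sym (lookup∘tabulate f j)))

module _ {m n} (X : Pattern m n) where

  ∈-Zrow : ∀ {i j} → j ∈ Zrow X i ⇔ X i j ≡ false
  ∈-Zrow = mk⇔ (to T-not-≡ ∘ to ∈-tabulate) (from ∈-tabulate ∘ from T-not-≡)

  ∈-Zset : ∀ {R j} → j ∈ Zset X R ⇔ (∀ {i} → i ∈ R → X i j ≡ false)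
  ∈-Zset {R} = mk⇔
    (λ j∈Z {i} i∈R → to ∈-Zrow (∈-⋂⁻ _ j∈Z
      (∈-map∘filter⁺ (Zrow X) (T? ∘ lookup R) (i , ∈-allFin i , refl , to ∈⇔T-lookup i∈R))))
    (λ vanishes → ∈-⋂⁺ _
      (∈-selected-row vanishes ∘ ∈-map∘filter⁻ (Zrow X) (T? ∘ lookup R) {xs = allFin m}))
    where
    ∈-selected-row : ∀ {p j} → (∀ {i} → i ∈ R → X i j ≡ false) →
                     Σ (Fin m) (λ i → i List.∈ allFin m × p ≡ Zrow X i × T (lookup R i)) → j ∈ p
    ∈-selected-row vanishes (i , _ , refl , i∈R) = from ∈-Zrow (vanishes (from ∈⇔T-lookup i∈R))

Zset-antitone : ∀ {m n} (X : Pattern m n) {R S : Subset m} → R ⊆ S → Zset X S ⊆ Zset X R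
Zset-antitone X R⊆S j∈ZS = from (∈-Zset X) (to (∈-Zset X) j∈ZS ∘ R⊆S)

⊆-Zsetᵀ∘Zset : ∀ {m n} (X : Pattern m n) {R : Subset m} → R ⊆ Zset (transpose X) (Zset X R)
⊆-Zsetᵀ∘Zset X i∈R = from (∈-Zset (transpose X)) λ j∈ZR → to (∈-Zset X) j∈ZR i∈R

Zset∘Zsetᵀ∘Zset : ∀ {m n} (X : Pattern m n) (R : Subset m) →
                  Zset X (Zset (transpose X) (Zset X R)) ≡ Zset X R
-- The second inclusion is ⊆-Zsetᵀ∘Zset for Xᵀ, as transpose (transpose X) is X by η.
Zset∘Zsetᵀ∘Zset X R =
  ⊆-antisym (Zset-antitone X (⊆-Zsetᵀ∘Zset X {R})) (⊆-Zsetᵀ∘Zset (transpose X))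

Zset∘Zsetᵀ-inverse-on-L : ∀ {m n} (X : Pattern m n) {A : Subset n} →
                          InL X A → Zset X (Zset (transpose X) A) ≡ A
Zset∘Zsetᵀ-inverse-on-L X (R , refl) = Zset∘Zsetᵀ∘Zset X R

theorem4p5 : ∀ {m n} (X : Pattern m n) →
    ((A : Subset n) → InL X A → InL (transpose X) (Zset (transpose X) A))
    × ((A B : Subset n) → InL X A → InL X B →
         Zset (transpose X) A ≡ Zset (transpose X) B → A ≡ B)
    × ((C : Subset m) → InL (transpose X) C →
         Σ (Subset n) (λ A → InL X A × Zset (transpose X) A ≡ C))
    × ((A B : Subset n) → InL X A → InL X B →
         (A ⊆ B ⇔ Zset (transpose X) B ⊆ Zset (transpose X) A))
theorem4p5 X =
    (λ A _ → A , refl)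
  , (λ A B A∈L B∈L ZA≡ZB → begin
       A                        ≡⟨ sym (inverse A∈L) ⟩
       Zset X (Zset Xᵀ A)       ≡⟨ cong (Zset X) ZA≡ZB ⟩
       Zset X (Zset Xᵀ B)       ≡⟨ inverse B∈L ⟩
       B                        ∎)
  , (λ C C∈Lᵀ → Zset X C , (C , refl) , Zset∘Zsetᵀ-inverse-on-L Xᵀ C∈Lᵀ)
  , (λ A B A∈L B∈L → mk⇔ (Zset-antitone Xᵀ)
       (subst₂ _⊆_ (inverse A∈L) (inverse B∈L) ∘ Zset-antitone X))
  where
  Xᵀ = transpose X
  inverse = Zset∘Zsetᵀ-inverse-on-L X
  open ≡-Reasoning
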